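{- Let $k\in\mathbb{N}$ and let $G_c=(V_c,E_c)$ be a connected simple undirected graph with vertices $V_c=\{v_1,\dots,v_{n_c}\}$. Construct the gadget graph $G_g=(V_g,E_g)$ from $G_c$ as follows: replace every edge of $G_c$ by a path of length $3$ (with two new interior vertices), and for every pair of distinct non-adjacent vertices of $G_c$ add a path of length $2$ between them (with one new interior vertex); all new vertices are distinct, and they are enumerated so that $V_g=\{v_1,\dots,v_{n_c},v_{n_c+1},\dots,v_{n_g}\}$ with $n_g=|V_g|$. Let $n=n_g+1$ and define the $n\times n$ matrix $D$ by $D_{ij}=d_{G_g}(v_i,v_j)$ for $i,j\in[n_g]$ (the shortest-path distance in $G_g$), $D_{in}=D_{ni}=2$ for $i\in[n_c]$, $D_{in}=D_{ni}=3$ for $i\in[n_g]\setminus[n_c]$, and $D_{nn}=0$. Then $G_c$ is $k$-colourable if and only if $D$ is a YES-instance of $k$-\textsc{CombDMR}.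
   Context: $[n]=\{1,\dots,n\}$. A graph $G=(V,E)$ is $k$-colourable if there is $\chi:V\to[k]$ with $\chi(u)\ne\chi(w)$ for every edge $\{u,w\}\in E$. For an $n\times n$ matrix $D$ with non-negative integer entries, a graph realisation of $D$ is a pair $(G,\Phi)$ where $G=(V,E)$ is a finite simple undirected unweighted graph and $\Phi:[n]\to V$ is injective with $d_G(\Phi(i),\Phi(j))=D_{ij}$ for all $i,j\in[n]$, $d_G$ the shortest-path distance. $D$ is a YES-instance of $k$-\textsc{CombDMR} if it has a graph realisation $(G,\Phi)$ with $|V|\le n+k$. -}

module Defs where

open import Data.Nat using (ℕ; zero; suc; _+_; _≤_; _<_)
open import Data.Fin using (Fin; toℕ; fromℕ<; inject₁; fromℕ)
import Data.Fin as F
open import Data.Bool using (Bool; true; false)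
open import Data.Product using (Σ; ∃; _×_; _,_)
open import Relation.Binary.PropositionalEquality using (_≡_; _≢_)
open import Relation.Nullary using (¬_)
open import Function.Definitions using (Injective; Bijective)

record SimpleGraph (V : ℕ) : Set where
  field
    adj   : Fin V → Fin V → Bool
    sym   : ∀ u w → adj u w ≡ adj w u
    irrfl : ∀ u → adj u u ≡ false

open SimpleGraph public

Edge : ∀ {V} → SimpleGraph V → Fin V → Fin V → Set
Edge G u w = adj G u w ≡ true

data Walk {A : Set} (R : A → A → Set) : A → A → ℕ → Set where
  nil  : ∀ {u} → Walk R u u 0
  cons : ∀ {u v w d} → R u v → Walk R v w d → Walk R u w (suc d)

IsDist : {A : Set} (R : A → A → Set) → A → A → ℕ → Set
IsDist R u w d = Walk R u w d × (∀ m → m < d → ¬ Walk R u w m)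

Connected : ∀ {V} → SimpleGraph V → Set
Connected G = ∀ u w → ∃ λ d → Walk (Edge G) u w d

Colourable : ∀ {V} → ℕ → SimpleGraph V → Set
Colourable {V} k G =
  Σ (Fin V → Fin k) λ χ → ∀ u w → Edge G u w → χ u ≢ χ w

IsRealisation : ∀ {n m} → (Fin n → Fin n → ℕ) → SimpleGraph m → (Fin n → Fin m) → Set
IsRealisation D G Φ =
  Injective _≡_ _≡_ Φ × (∀ i j → IsDist (Edge G) (Φ i) (Φ j) (D i j))

CombDMR-YES : ∀ {n} → ℕ → (Fin n → Fin n → ℕ) → Set
CombDMR-YES {n} k D =
  ∃ λ m → m ≤ n + k × Σ (SimpleGraph m) λ G → Σ (Fin n → Fin m) λ Φ → IsRealisation D G Φ

module Gadget {nc : ℕ} (Gc : SimpleGraph nc) where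

  data GV : Set where
    orig : Fin nc → GV
    sub  : (i j : Fin nc) → i F.< j → Edge Gc i j → Fin 2 → GV
    mid  : (i j : Fin nc) → i F.< j → adj Gc i j ≡ false → GV

  data Arc : GV → GV → Set where
    e-i0 : ∀ {i j} (p : i F.< j) (e : Edge Gc i j) → Arc (orig i) (sub i j p e F.zero)
    e-01 : ∀ {i j} (p : i F.< j) (e : Edge Gc i j) → Arc (sub i j p e F.zero) (sub i j p e (F.suc F.zero))
    e-1j : ∀ {i j} (p : i F.< j) (e : Edge Gc i j) → Arc (sub i j p e (F.suc F.zero)) (orig j)
    m-i  : ∀ {i j} (p : i F.< j) (e : adj Gc i j ≡ false) → Arc (orig i) (mid i j p e)
    m-j  : ∀ {i j} (p : i F.< j) (e : adj Gc i j ≡ false) → Arc (mid i j p e) (orig j)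

  data GEdge : GV → GV → Set where
    fwd : ∀ {u w} → Arc u w → GEdge u w
    bwd : ∀ {u w} → Arc w u → GEdge u w

  -- The matrix D, specified by its defining equations, relative to an
  -- enumeration e : Fin ng → GV of V_g listing v_1..v_nc first.
  IsGadgetMatrix : (ng : ℕ) → (Fin ng → GV) → (Fin (suc ng) → Fin (suc ng) → ℕ) → Set
  IsGadgetMatrix ng e D =
      (∀ i j → IsDist GEdge (e i) (e j) (D (inject₁ i) (inject₁ j)))
    × (∀ i → toℕ i < nc → D (inject₁ i) (fromℕ ng) ≡ 2 × D (fromℕ ng) (inject₁ i) ≡ 2)
    × (∀ i → ¬ (toℕ i < nc) → D (inject₁ i) (fromℕ ng) ≡ 3 × D (fromℕ ng) (inject₁ i) ≡ 3)
    × D (fromℕ ng) (fromℕ ng) ≡ 0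

  IsEnumeration : (ng : ℕ) → (Fin ng → GV) → Set
  IsEnumeration ng e =
    Bijective _≡_ _≡_ e × (∀ i (h : toℕ i < nc) → e i ≡ orig (fromℕ< h))

{-# OPTIONS --safe #-}
-- From a proper k-colouring χ of G_c, add to G_g a vertex for the point n (the hub) and k colour
-- vertices, joining the hub to every colour vertex and colour a to the original vertices v with
-- χ v = a. The hub is then at distance 2 from original and 3 from other vertices, and no distance
-- in G_g shrinks: two original vertices of the same colour are non-adjacent, hence at distance ≤ 2
-- in G_g, and any two original vertices are at distance ≤ 3.
-- Conversely, in a realisation on at most n + k vertices each original vertex reaches the hub in
-- two steps, through a neighbour of the hub. No Φ i neighbours the hub (D i n ≠ 1), so there are
-- at most k such neighbours, and colouring each original vertex by its neighbour of the hub is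
-- proper: adjacent vertices of G_c are at distance 3 in G_g, so their images share no neighbour.
module Submission where

open import Defs hiding (sym)
open import Data.Nat using (ℕ; suc; _+_; _≤_; _<_; z≤n; s≤s; _<?_)
open import Data.Nat.Properties
  using (≤-refl; ≤-trans; ≤-<-trans; m≤m+n; <⇒≱; m≤n⇒m≤1+n; n≤1+n;
         +-suc; +-identityʳ; +-monoˡ-≤; +-cancelˡ-≤)
open import Data.Fin using (Fin; toℕ; fromℕ; fromℕ<; inject₁; inject≤; _↑ˡ_; _↑ʳ_; splitAt)
import Data.Fin as F
open import Data.Fin.Properties
  using (_≟_; <-cmp; <-irrelevant; +↔⊎; injective⇒≤; inject≤-injective; toℕ-inject≤; toℕ-fromℕ<;
         toℕ<n; toℕ-injective; splitAt-↑ˡ; splitAt-↑ʳ)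
open import Data.Fin.Relation.Unary.Top using (view; ‵fromℕ; ‵inject₁; view-fromℕ; view-inject₁)
open import Data.Bool using (Bool; true; false)
import Data.Bool.Properties as Bool
open import Data.Sum using (_⊎_; inj₁; inj₂; [_,_])
open import Data.Product using (∃; _×_; _,_; proj₁; proj₂)
open import Data.List using (List; filter; allFin; length; lookup)
open import Data.List.Membership.Propositional.Properties using (∈-filter⁺; ∈-filter⁻; ∈-allFin; ∈-lookup)
open import Data.List.Relation.Unary.All as All using ()
open import Data.List.Relation.Unary.AllPairs using (_∷_)
open import Data.List.Relation.Unary.Any using (index)
open import Data.List.Relation.Unary.Any.Properties using (lookup-index)
open import Data.List.Relation.Unary.Unique.Propositional using (Unique)
open import Data.List.Relation.Unary.Unique.Propositional.Properties using (allFin⁺; filter⁺)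
open import Axiom.UniquenessOfIdentityProofs using (module Decidable⇒UIP)
open import Relation.Binary.PropositionalEquality
  using (_≡_; _≢_; refl; sym; trans; cong; subst; subst₂)
open import Relation.Binary.Definitions using (Symmetric; Decidable; tri<; tri≈; tri>)
import Relation.Unary as U
open import Relation.Nullary using (¬_; yes; no; does; contradiction)
open import Relation.Nullary.Decidable using (dec-true; dec-false; map′)
open import Function using (_∘_)
open import Level using (0ℓ)
open import Function.Bundles using (_⇔_; mk⇔; Injection)
open import Function.Definitions using (Injective)
open import Function.Properties.Inverse using (↔⇒↣)

module _ {A : Set} {R : A → A → Set} where

  infixr 5 _++ᵂ_

  _++ᵂ_ : ∀ {u v w a b} → Walk R u v a → Walk R v w b → Walk R u w (a + b)
  nil      ++ᵂ W = W
  cons r V ++ᵂ W = cons r (V ++ᵂ W)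

  module _ (R-sym : Symmetric R) where

    reverse-onto : ∀ {u v w a b} → Walk R u v a → Walk R u w b → Walk R v w (a + b)
    reverse-onto nil acc = acc
    reverse-onto {b = b} (cons {d = d} r W) acc =
      subst (Walk R _ _) (+-suc d b) (reverse-onto W (cons (R-sym r) acc))

    reverseᵂ : ∀ {u v a} → Walk R u v a → Walk R v u a
    reverseᵂ {a = a} W = subst (Walk R _ _) (+-identityʳ a) (reverse-onto W nil)

    IsDist-sym : ∀ {u v d} → IsDist R u v d → IsDist R v u d
    IsDist-sym (W , shortest) = reverseᵂ W , λ m m<d V → shortest m m<d (reverseᵂ V)

  midpoint : ∀ {u v} → Walk R u v 2 → ∃ λ c → R u c × R c v
  midpoint (cons r (cons r′ nil)) = _ , r , r′

mapᵂ : ∀ {A B : Set} {R : A → A → Set} {S : B → B → Set} (f : A → B) →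
       (∀ {x y} → R x y → S (f x) (f y)) → ∀ {u v d} → Walk R u v d → Walk S (f u) (f v) d
mapᵂ f g nil        = nil
mapᵂ f g (cons r W) = cons (g r) (mapᵂ f g W)

module RelationGraph {A : Set} (R : A → A → Set) (R? : Decidable R)
                     (R-sym : Symmetric R) (R-irrefl : ∀ {x} → ¬ R x x)
                     {N : ℕ} (decode : Fin N → A) (code : A → Fin N)
                     (decode-code : ∀ a → decode (code a) ≡ a) where

  graph : SimpleGraph N
  graph = record
    { adj   = λ x y → does (R? (decode x) (decode y))
    ; sym   = λ x y → adj-sym (decode x) (decode y)
    ; irrfl = λ x → dec-false (R? _ _) R-irrefl
    }
    where
      adj-sym : ∀ a b → does (R? a b) ≡ does (R? b a)
      adj-sym a b with R? a b
      ... | yes r = sym (dec-true (R? b a) (R-sym r))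
      ... | no ¬r = sym (dec-false (R? b a) (¬r ∘ R-sym))

  edge⇒R : ∀ {x y} → Edge graph x y → R (decode x) (decode y)
  edge⇒R {x} {y} _ with R? (decode x) (decode y)
  edge⇒R _  | yes r = r

  R⇒edge : ∀ {a b} → R a b → Edge graph (code a) (code b)
  R⇒edge {a} {b} r = dec-true (R? _ _) (subst₂ R (sym (decode-code a)) (sym (decode-code b)) r)

  code-injective : Injective _≡_ _≡_ code
  code-injective {a} {b} eq = trans (sym (decode-code a)) (trans (cong decode eq) (decode-code b))

  code-preserves-IsDist : ∀ {a b d} → IsDist R a b d → IsDist (Edge graph) (code a) (code b) d
  code-preserves-IsDist {a} {b} (W , shortest) =
      mapᵂ code R⇒edge W
    , λ m m<d V → shortest m m<d
        (subst₂ (λ x y → Walk R x y m) (decode-code a) (decode-code b) (mapᵂ decode edge⇒R V))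

lookup-injective : ∀ {A : Set} {xs : List A} → Unique xs → Injective _≡_ _≡_ (lookup xs)
lookup-injective (_ ∷ _)      {F.zero}  {F.zero}  _  = refl
lookup-injective (x∉xs ∷ _)   {F.zero}  {F.suc j} eq = contradiction eq (All.lookup x∉xs (∈-lookup j))
lookup-injective (x∉xs ∷ _)   {F.suc i} {F.zero}  eq = contradiction (sym eq) (All.lookup x∉xs (∈-lookup i))
lookup-injective (_ ∷ xs-uniq) {F.suc i} {F.suc j} eq = cong F.suc (lookup-injective xs-uniq eq)

module _ {m : ℕ} {P : U.Pred (Fin m) 0ℓ} (P? : U.Decidable P) where

  private
    satisfying : List (Fin m)
    satisfying = filter P? (allFin m)

  rank : ∀ {x} → P x → Fin (length (filter P? (allFin m)))
  rank px = index (∈-filter⁺ P? (∈-allFin _) px)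

  rank-injective : ∀ {x y} (px : P x) (py : P y) → rank px ≡ rank py → x ≡ y
  rank-injective px py eq = trans (lookup-index (∈-filter⁺ P? (∈-allFin _) px))
                           (trans (cong (lookup satisfying) eq)
                                  (sym (lookup-index (∈-filter⁺ P? (∈-allFin _) py))))

  +-length-filter≤ : ∀ {n} {Φ : Fin n → Fin m} → Injective _≡_ _≡_ Φ → (∀ i → ¬ P (Φ i)) →
                     n + length (filter P? (allFin m)) ≤ m
  +-length-filter≤ {n} {Φ} Φ-inj Φ∉P =
    injective⇒≤ (λ eq → Injection.injective (↔⇒↣ +↔⊎) ([Φ,lookup]-injective eq))
    where
      P-lookup : ∀ j → P (lookup satisfying j)
      P-lookup j = proj₂ (∈-filter⁻ P? {xs = allFin m} (∈-lookup j))

      [Φ,lookup]-injective : Injective _≡_ _≡_ [ Φ , lookup satisfying ]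
      [Φ,lookup]-injective {inj₁ i} {inj₁ j} eq = cong inj₁ (Φ-inj eq)
      [Φ,lookup]-injective {inj₁ i} {inj₂ j} eq = contradiction (subst P (sym eq) (P-lookup j)) (Φ∉P i)
      [Φ,lookup]-injective {inj₂ i} {inj₁ j} eq = contradiction (subst P eq (P-lookup i)) (Φ∉P j)
      [Φ,lookup]-injective {inj₂ i} {inj₂ j} eq =
        cong inj₂ (lookup-injective (filter⁺ P? (allFin⁺ m)) eq)

module GadgetGraph {nc : ℕ} (Gc : SimpleGraph nc) where
  open Gadget Gc

  private
    bool-irrelevant : ∀ {b c : Bool} (p q : b ≡ c) → p ≡ q
    bool-irrelevant = Decidable⇒UIP.≡-irrelevant Bool._≟_

    edge-irrefl : ∀ {u} → ¬ Edge Gc u u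
    edge-irrefl {u} e = contradiction (trans (sym e) (irrfl Gc u)) λ ()

    adj-flip : ∀ {u v b} → adj Gc u v ≡ b → adj Gc v u ≡ b
    adj-flip {u} {v} uv = trans (SimpleGraph.sym Gc v u) uv

  Arc? : Decidable Arc
  Arc? (orig a) (orig b) = no λ ()
  Arc? (orig a) (sub i j p e F.zero) with a ≟ i
  ... | yes refl = yes (e-i0 p e)
  ... | no a≢i   = no λ { (e-i0 _ _) → a≢i refl }
  Arc? (orig a) (sub i j p e (F.suc F.zero)) = no λ ()
  Arc? (orig a) (mid i j p e) with a ≟ i
  ... | yes refl = yes (m-i p e)
  ... | no a≢i   = no λ { (m-i _ _) → a≢i refl }
  Arc? (sub i j p e F.zero) (orig b) = no λ ()
  Arc? (sub i j p e F.zero) (sub i′ j′ p′ e′ F.zero) = no λ ()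
  Arc? (sub i j p e F.zero) (sub i′ j′ p′ e′ (F.suc F.zero)) with i ≟ i′ | j ≟ j′
  ... | no i≢i′ | _        = no λ { (e-01 _ _) → i≢i′ refl }
  ... | yes _   | no j≢j′  = no λ { (e-01 _ _) → j≢j′ refl }
  ... | yes refl | yes refl with <-irrelevant p p′ | bool-irrelevant e e′
  ...   | refl | refl = yes (e-01 p e)
  Arc? (sub i j p e F.zero) (mid _ _ _ _) = no λ ()
  Arc? (sub i j p e (F.suc F.zero)) (orig b) with j ≟ b
  ... | yes refl = yes (e-1j p e)
  ... | no j≢b   = no λ { (e-1j _ _) → j≢b refl }
  Arc? (sub i j p e (F.suc F.zero)) (sub _ _ _ _ _) = no λ ()
  Arc? (sub i j p e (F.suc F.zero)) (mid _ _ _ _) = no λ ()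
  Arc? (mid i j p e) (orig b) with j ≟ b
  ... | yes refl = yes (m-j p e)
  ... | no j≢b   = no λ { (m-j _ _) → j≢b refl }
  Arc? (mid i j p e) (sub _ _ _ _ _) = no λ ()
  Arc? (mid i j p e) (mid _ _ _ _) = no λ ()

  GEdge? : Decidable GEdge
  GEdge? u w with Arc? u w | Arc? w u
  ... | yes a | _     = yes (fwd a)
  ... | no _  | yes a = yes (bwd a)
  ... | no ¬a | no ¬b = no λ { (fwd a) → ¬a a ; (bwd b) → ¬b b }

  GEdge-sym : Symmetric GEdge
  GEdge-sym (fwd a) = bwd a
  GEdge-sym (bwd a) = fwd a

  GEdge-irrefl : ∀ {u} → ¬ GEdge u u
  GEdge-irrefl (fwd ())
  GEdge-irrefl (bwd ())

  midWalk : ∀ {u v} → adj Gc u v ≡ false → u ≢ v → Walk GEdge (orig u) (orig v) 2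
  midWalk {u} {v} ¬e u≢v with <-cmp u v
  ... | tri< u<v _ _ = cons (fwd (m-i u<v ¬e)) (cons (fwd (m-j u<v ¬e)) nil)
  ... | tri≈ _ u≡v _ = contradiction u≡v u≢v
  ... | tri> _ _ v<u = cons (bwd (m-j v<u ¬e′)) (cons (bwd (m-i v<u ¬e′)) nil)
    where ¬e′ = adj-flip ¬e

  subWalk : ∀ {u v} → Edge Gc u v → Walk GEdge (orig u) (orig v) 3
  subWalk {u} {v} e with <-cmp u v
  ... | tri< u<v _ _ = cons (fwd (e-i0 u<v e)) (cons (fwd (e-01 u<v e)) (cons (fwd (e-1j u<v e)) nil))
  ... | tri≈ _ refl _ = contradiction e edge-irrefl
  ... | tri> _ _ v<u = cons (bwd (e-1j v<u e′)) (cons (bwd (e-01 v<u e′)) (cons (bwd (e-i0 v<u e′)) nil))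
    where e′ = adj-flip e

  nonadjacent-walk≤2 : ∀ u v → adj Gc u v ≡ false → ∃ λ L → L ≤ 2 × Walk GEdge (orig u) (orig v) L
  nonadjacent-walk≤2 u v ¬e with u ≟ v
  ... | yes refl = 0 , z≤n , nil
  ... | no u≢v   = 2 , ≤-refl , midWalk ¬e u≢v

  orig-walk≤3 : ∀ u v → ∃ λ L → L ≤ 3 × Walk GEdge (orig u) (orig v) L
  orig-walk≤3 u v with adj Gc u v in e
  ... | true  = 3 , ≤-refl , subWalk e
  ... | false with nonadjacent-walk≤2 u v e
  ...   | L , L≤2 , W = L , m≤n⇒m≤1+n L≤2 , W

  adjacent⇒2<walk-length : ∀ {u v d} → Edge Gc u v → Walk GEdge (orig u) (orig v) d → 2 < d
  adjacent⇒2<walk-length e nil = contradiction e edge-irrefl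
  adjacent⇒2<walk-length e (cons (fwd ()) nil)
  adjacent⇒2<walk-length e (cons (bwd ()) nil)
  adjacent⇒2<walk-length e (cons (fwd (e-i0 _ _)) (cons (bwd (e-i0 _ _)) nil)) = contradiction e edge-irrefl
  adjacent⇒2<walk-length e (cons (bwd (e-1j _ _)) (cons (fwd (e-1j _ _)) nil)) = contradiction e edge-irrefl
  adjacent⇒2<walk-length e (cons (fwd (m-i _ _)) (cons (bwd (m-i _ _)) nil))   = contradiction e edge-irrefl
  adjacent⇒2<walk-length e (cons (bwd (m-j _ _)) (cons (fwd (m-j _ _)) nil))   = contradiction e edge-irrefl
  adjacent⇒2<walk-length e (cons (fwd (m-i _ ¬e)) (cons (fwd (m-j _ _)) nil))  =
    contradiction (trans (sym e) ¬e) λ ()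
  adjacent⇒2<walk-length e (cons (bwd (m-j _ ¬e)) (cons (bwd (m-i _ _)) nil))  =
    contradiction (trans (sym (adj-flip e)) ¬e) λ ()
  adjacent⇒2<walk-length e (cons _ (cons _ (cons _ _))) = s≤s (s≤s (s≤s z≤n))

  NonOriginal : GV → Set
  NonOriginal u = ∀ v → u ≢ orig v

  originalNeighbour : ∀ u → NonOriginal u → ∃ λ v → GEdge (orig v) u
  originalNeighbour (orig v) ¬orig = contradiction refl (¬orig v)
  originalNeighbour (sub i j p e F.zero) _ = i , fwd (e-i0 p e)
  originalNeighbour (sub i j p e (F.suc F.zero)) _ = j , bwd (e-1j p e)
  originalNeighbour (mid i j p e) _ = i , fwd (m-i p e)

module ColourExtension {nc k : ℕ} (Gc : SimpleGraph nc) (χ : Fin nc → Fin k)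
                       (proper : ∀ u w → Edge Gc u w → χ u ≢ χ w) where
  open Gadget Gc
  open GadgetGraph Gc

  data HV : Set where
    gadget : GV → HV
    hub    : HV
    colour : Fin k → HV

  data HEdge : HV → HV → Set where
    gadget      : ∀ {u w} → GEdge u w → HEdge (gadget u) (gadget w)
    hub-colour  : ∀ {a} → HEdge hub (colour a)
    colour-hub  : ∀ {a} → HEdge (colour a) hub
    orig-colour : ∀ {v a} → χ v ≡ a → HEdge (gadget (orig v)) (colour a)
    colour-orig : ∀ {v a} → χ v ≡ a → HEdge (colour a) (gadget (orig v))

  HEdge? : Decidable HEdge
  HEdge? (gadget u) (gadget w) = map′ gadget (λ { (gadget g) → g }) (GEdge? u w)
  HEdge? (gadget (orig v)) (colour a) = map′ orig-colour (λ { (orig-colour c) → c }) (χ v ≟ a)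
  HEdge? (colour a) (gadget (orig v)) = map′ colour-orig (λ { (colour-orig c) → c }) (χ v ≟ a)
  HEdge? hub (colour a) = yes hub-colour
  HEdge? (colour a) hub = yes colour-hub
  HEdge? (gadget u) hub = no λ ()
  HEdge? (gadget (sub _ _ _ _ _)) (colour a) = no λ ()
  HEdge? (gadget (mid _ _ _ _)) (colour a) = no λ ()
  HEdge? hub (gadget w) = no λ ()
  HEdge? hub hub = no λ ()
  HEdge? (colour a) (gadget (sub _ _ _ _ _)) = no λ ()
  HEdge? (colour a) (gadget (mid _ _ _ _)) = no λ ()
  HEdge? (colour a) (colour b) = no λ ()

  HEdge-sym : Symmetric HEdge
  HEdge-sym (gadget g)      = gadget (GEdge-sym g)
  HEdge-sym hub-colour      = colour-hub
  HEdge-sym colour-hub      = hub-colour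
  HEdge-sym (orig-colour c) = colour-orig c
  HEdge-sym (colour-orig c) = orig-colour c

  HEdge-irrefl : ∀ {x} → ¬ HEdge x x
  HEdge-irrefl (gadget g) = GEdge-irrefl g

  same-colour⇒nonadjacent : ∀ {u v} → χ u ≡ χ v → adj Gc u v ≡ false
  same-colour⇒nonadjacent {u} {v} χu≡χv with adj Gc u v in e
  ... | true  = contradiction χu≡χv (proper u v e)
  ... | false = refl

  -- A walk of length L from x to gadget w shortens to a walk in G_g: from x itself if x is
  -- in G_g, otherwise from an original vertex v, saving the cost of getting from x to v
  -- (2 from the hub; from colour a, 1 if χ v ≡ a and 3 in any case).
  Shortcut : GV → HV → ℕ → Set
  Shortcut w (gadget u) L = ∃ λ L′ → L′ ≤ L × Walk GEdge u w L′
  Shortcut w hub        L = ∃ λ v → ∃ λ L′ → 2 + L′ ≤ L × Walk GEdge (orig v) w L′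
  Shortcut w (colour a) L =
    ∃ λ v → ∃ λ L′ → Walk GEdge (orig v) w L′ × ((χ v ≡ a × 1 + L′ ≤ L) ⊎ 3 + L′ ≤ L)

  Shortcut-step : ∀ {w x y L} → HEdge x y → Shortcut w y L → Shortcut w x (suc L)
  Shortcut-step (gadget g) (L′ , L′≤L , W) = suc L′ , s≤s L′≤L , cons g W
  Shortcut-step {x = gadget (orig u)} (orig-colour χu≡a) (v , L′ , W , inj₁ (χv≡a , L′<L))
    with nonadjacent-walk≤2 u v (same-colour⇒nonadjacent (trans χu≡a (sym χv≡a)))
  ... | L″ , L″≤2 , V = L″ + L′ , ≤-trans (+-monoˡ-≤ L′ L″≤2) (s≤s L′<L) , V ++ᵂ W
  Shortcut-step {x = gadget (orig u)} (orig-colour _) (v , L′ , W , inj₂ 3+L′≤L)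
    with orig-walk≤3 u v
  ... | L″ , L″≤3 , V = L″ + L′ , m≤n⇒m≤1+n (≤-trans (+-monoˡ-≤ L′ L″≤3) 3+L′≤L) , V ++ᵂ W
  Shortcut-step hub-colour (v , L′ , W , inj₁ (_ , L′<L)) = v , L′ , s≤s L′<L , W
  Shortcut-step hub-colour (v , L′ , W , inj₂ 3+L′≤L) =
    v , L′ , m≤n⇒m≤1+n (≤-trans (n≤1+n _) 3+L′≤L) , W
  Shortcut-step (colour-orig {v} χv≡a) (L′ , L′≤L , W) = v , L′ , W , inj₁ (χv≡a , s≤s L′≤L)
  Shortcut-step colour-hub (v , L′ , 2+L′≤L , W) = v , L′ , W , inj₂ (s≤s 2+L′≤L)

  shortcut : ∀ {w x L} → Walk HEdge x (gadget w) L → Shortcut w x L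
  shortcut nil        = 0 , z≤n , nil
  shortcut (cons h W) = Shortcut-step h (shortcut W)

  gadget-preserves-IsDist : ∀ {u w d} → IsDist GEdge u w d → IsDist HEdge (gadget u) (gadget w) d
  gadget-preserves-IsDist (W , shortest) =
      mapᵂ gadget gadget W
    , λ m m<d V → let L′ , L′≤m , W′ = shortcut V in shortest L′ (≤-<-trans L′≤m m<d) W′

  hub-orig-IsDist : ∀ v → IsDist HEdge hub (gadget (orig v)) 2
  hub-orig-IsDist v = cons hub-colour (cons (colour-orig refl) nil) , shortest
    where
      shortest : ∀ m → m < 2 → ¬ Walk HEdge hub (gadget (orig v)) m
      shortest m m<2 V with shortcut V
      ... | _ , L′ , 2+L′≤m , _ = contradiction (≤-trans (m≤m+n 2 L′) 2+L′≤m) (<⇒≱ m<2)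

  hub-nonOriginal-IsDist : ∀ u → NonOriginal u → IsDist HEdge hub (gadget u) 3
  hub-nonOriginal-IsDist u ¬orig =
    cons hub-colour (cons (colour-orig refl) (cons (gadget g) nil)) , shortest
    where
      g = proj₂ (originalNeighbour u ¬orig)

      shortest : ∀ m → m < 3 → ¬ Walk HEdge hub (gadget u) m
      shortest m m<3 V with shortcut V
      ... | v , _ , _ , nil = ¬orig v refl
      ... | _ , suc L′ , 3+L′≤m , cons _ _ = contradiction (≤-trans (m≤m+n 3 L′) 3+L′≤m) (<⇒≱ m<3)

module Reduction {k nc : ℕ} (Gc : SimpleGraph nc)
                 {ng : ℕ} {e : Fin ng → Gadget.GV Gc} (enum : Gadget.IsEnumeration Gc ng e)
                 {D : Fin (suc ng) → Fin (suc ng) → ℕ} (gm : Gadget.IsGadgetMatrix Gc ng e D) where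
  open Gadget Gc
  open GadgetGraph Gc

  hubIndex : Fin (suc ng)
  hubIndex = fromℕ ng

  e-injective : Injective _≡_ _≡_ e
  e-injective = proj₁ (proj₁ enum)

  e-orig : ∀ a (a<nc : toℕ a < nc) → e a ≡ orig (fromℕ< a<nc)
  e-orig = proj₂ enum

  e⁻¹ : GV → Fin ng
  e⁻¹ u = proj₁ (proj₂ (proj₁ enum) u)

  e-e⁻¹ : ∀ u → e (e⁻¹ u) ≡ u
  e-e⁻¹ u = proj₂ (proj₂ (proj₁ enum) u) refl

  nc≤ng : nc ≤ ng
  nc≤ng = injective⇒≤ λ {v} {w} eq →
    orig-injective (trans (sym (e-e⁻¹ (orig v))) (trans (cong e eq) (e-e⁻¹ (orig w))))
    where
      orig-injective : ∀ {v w} → orig v ≡ orig w → v ≡ w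
      orig-injective refl = refl

  origIndex : Fin nc → Fin ng
  origIndex v = inject≤ v nc≤ng

  origIndex<nc : ∀ v → toℕ (origIndex v) < nc
  origIndex<nc v = subst (_< nc) (sym (toℕ-inject≤ v nc≤ng)) (toℕ<n v)

  e-origIndex : ∀ v → e (origIndex v) ≡ orig v
  e-origIndex v = trans (e-orig (origIndex v) (origIndex<nc v))
    (cong orig (toℕ-injective (trans (toℕ-fromℕ< (origIndex<nc v)) (toℕ-inject≤ v nc≤ng))))

  high-index⇒NonOriginal : ∀ a → ¬ toℕ a < nc → NonOriginal (e a)
  high-index⇒NonOriginal a a≮nc v ea≡v =
    a≮nc (subst (λ b → toℕ b < nc) (e-injective (trans (e-origIndex v) (sym ea≡v))) (origIndex<nc v))

  D-gadget : ∀ a b → IsDist GEdge (e a) (e b) (D (inject₁ a) (inject₁ b))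
  D-gadget = proj₁ gm

  D-orig-hub : ∀ a → toℕ a < nc → D (inject₁ a) hubIndex ≡ 2 × D hubIndex (inject₁ a) ≡ 2
  D-orig-hub = proj₁ (proj₂ gm)

  D-nonOriginal-hub : ∀ a → ¬ toℕ a < nc → D (inject₁ a) hubIndex ≡ 3 × D hubIndex (inject₁ a) ≡ 3
  D-nonOriginal-hub = proj₁ (proj₂ (proj₂ gm))

  D-hub-hub : D hubIndex hubIndex ≡ 0
  D-hub-hub = proj₂ (proj₂ (proj₂ gm))

  D-hub-sym : ∀ a → D (inject₁ a) hubIndex ≡ D hubIndex (inject₁ a)
  D-hub-sym a with toℕ a <? nc
  ... | yes a<nc = let D₁ , D₂ = D-orig-hub a a<nc in trans D₁ (sym D₂)
  ... | no a≮nc  = let D₁ , D₂ = D-nonOriginal-hub a a≮nc in trans D₁ (sym D₂)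

  module FromColouring (χ : Fin nc → Fin k) (proper : ∀ u w → Edge Gc u w → χ u ≢ χ w) where
    open ColourExtension Gc χ proper

    label : Fin (suc ng) → HV
    label i with view i
    ... | ‵fromℕ     = hub
    ... | ‵inject₁ a = gadget (e a)

    label-inject₁ : ∀ a → label (inject₁ a) ≡ gadget (e a)
    label-inject₁ a rewrite view-inject₁ a = refl

    label-hub : label hubIndex ≡ hub
    label-hub rewrite view-fromℕ ng = refl

    label-injective : Injective _≡_ _≡_ label
    label-injective {i} {j} eq with view i | view j
    ... | ‵fromℕ     | ‵fromℕ     = refl
    ... | ‵inject₁ a | ‵inject₁ b = cong inject₁ (e-injective (gadget-injective eq))
      where
        gadget-injective : ∀ {u w} → gadget u ≡ gadget w → u ≡ w
        gadget-injective refl = refl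
    ... | ‵fromℕ     | ‵inject₁ b with () ← eq
    ... | ‵inject₁ a | ‵fromℕ     with () ← eq

    hub-IsDist : ∀ a → IsDist HEdge hub (gadget (e a)) (D hubIndex (inject₁ a))
    hub-IsDist a with toℕ a <? nc
    ... | yes a<nc rewrite proj₂ (D-orig-hub a a<nc) | e-orig a a<nc = hub-orig-IsDist (fromℕ< a<nc)
    ... | no a≮nc  rewrite proj₂ (D-nonOriginal-hub a a≮nc) =
      hub-nonOriginal-IsDist (e a) (high-index⇒NonOriginal a a≮nc)

    label-IsDist : ∀ i j → IsDist HEdge (label i) (label j) (D i j)
    label-IsDist i j with view i | view j
    ... | ‵inject₁ a | ‵inject₁ b = gadget-preserves-IsDist (D-gadget a b)
    ... | ‵fromℕ     | ‵inject₁ b = hub-IsDist b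
    ... | ‵inject₁ a | ‵fromℕ     rewrite D-hub-sym a = IsDist-sym HEdge-sym (hub-IsDist a)
    ... | ‵fromℕ     | ‵fromℕ     rewrite D-hub-hub = nil , λ _ ()

    -- Vertices of the realisation: the n matrix indices, then the k colours.
    decode : Fin (suc ng + k) → HV
    decode x = [ label , colour ] (splitAt (suc ng) x)

    code : HV → Fin (suc ng + k)
    code (gadget u) = inject₁ (e⁻¹ u) ↑ˡ k
    code hub        = hubIndex ↑ˡ k
    code (colour a) = suc ng ↑ʳ a

    decode-code : ∀ x → decode (code x) ≡ x
    decode-code (gadget u) rewrite splitAt-↑ˡ (suc ng) (inject₁ (e⁻¹ u)) k | label-inject₁ (e⁻¹ u) =
      cong gadget (e-e⁻¹ u)
    decode-code hub        rewrite splitAt-↑ˡ (suc ng) hubIndex k = label-hub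
    decode-code (colour a) rewrite splitAt-↑ʳ (suc ng) k a = refl

    open RelationGraph HEdge HEdge? HEdge-sym HEdge-irrefl decode code decode-code

    realisation : CombDMR-YES k D
    realisation =
      suc ng + k , ≤-refl , graph , code ∘ label ,
      label-injective ∘ code-injective , λ i j → code-preserves-IsDist (label-IsDist i j)

  colourable⇒CombDMR-YES : Colourable k Gc → CombDMR-YES k D
  colourable⇒CombDMR-YES (χ , proper) = FromColouring.realisation χ proper

  origRow : Fin nc → Fin (suc ng)
  origRow v = inject₁ (origIndex v)

  D-origRow-hub : ∀ v → D (origRow v) hubIndex ≡ 2
  D-origRow-hub v = proj₁ (D-orig-hub (origIndex v) (origIndex<nc v))

  1<D-hub : ∀ a → 1 < D (inject₁ a) hubIndex
  1<D-hub a with toℕ a <? nc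
  ... | yes a<nc rewrite proj₁ (D-orig-hub a a<nc)        = s≤s (s≤s z≤n)
  ... | no a≮nc  rewrite proj₁ (D-nonOriginal-hub a a≮nc) = s≤s (s≤s z≤n)

  adjacent⇒2<D : ∀ {u v} → Edge Gc u v → 2 < D (origRow u) (origRow v)
  adjacent⇒2<D {u} {v} uv = adjacent⇒2<walk-length uv
    (subst₂ (λ x y → Walk GEdge x y (D (origRow u) (origRow v))) (e-origIndex u) (e-origIndex v)
            (proj₁ (D-gadget (origIndex u) (origIndex v))))

  CombDMR-YES⇒colourable : CombDMR-YES k D → Colourable k Gc
  CombDMR-YES⇒colourable (m , m≤n+k , G , Φ , Φ-injective , Φ-IsDist) = χ , proper
    where
      s : Fin m
      s = Φ hubIndex

      HubNeighbour : U.Pred (Fin m) 0ℓ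
      HubNeighbour w = Edge G w s

      HubNeighbour? : U.Decidable HubNeighbour
      HubNeighbour? w = adj G w s Bool.≟ true

      Φ-not-HubNeighbour : ∀ i → ¬ HubNeighbour (Φ i)
      Φ-not-HubNeighbour i Φi-s with view i
      ... | ‵fromℕ     = contradiction (trans (sym Φi-s) (irrfl G s)) λ ()
      ... | ‵inject₁ a = proj₂ (Φ-IsDist (inject₁ a) hubIndex) 1 (1<D-hub a) (cons Φi-s nil)

      hubNeighbours≤k : length (filter HubNeighbour? (allFin m)) ≤ k
      hubNeighbours≤k = +-cancelˡ-≤ (suc ng) _ _
        (≤-trans (+-length-filter≤ HubNeighbour? Φ-injective Φ-not-HubNeighbour) m≤n+k)

      via : ∀ v → ∃ λ w → Edge G (Φ (origRow v)) w × HubNeighbour w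
      via v = midpoint (subst (Walk (Edge G) _ _) (D-origRow-hub v)
                              (proj₁ (Φ-IsDist (origRow v) hubIndex)))

      χ : Fin nc → Fin k
      χ v = inject≤ (rank HubNeighbour? (proj₂ (proj₂ (via v)))) hubNeighbours≤k

      proper : ∀ u v → Edge Gc u v → χ u ≢ χ v
      proper u v uv χu≡χv = proj₂ (Φ-IsDist (origRow u) (origRow v)) 2 (adjacent⇒2<D uv)
        (cons (proj₁ (proj₂ (via u))) (cons w-v nil))
        where
          same-via : proj₁ (via u) ≡ proj₁ (via v)
          same-via = rank-injective HubNeighbour? _ _ (inject≤-injective _ _ _ _ χu≡χv)

          w-v : Edge G (proj₁ (via u)) (Φ (origRow v))
          w-v = subst (λ w → Edge G w _) (sym same-via)
                      (trans (SimpleGraph.sym G _ _) (proj₁ (proj₂ (via v))))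

theorem16 : (k nc : ℕ) (Gc : SimpleGraph nc) → Connected Gc →
            (ng : ℕ) (e : Fin ng → Gadget.GV Gc) → Gadget.IsEnumeration Gc ng e →
            (D : Fin (suc ng) → Fin (suc ng) → ℕ) → Gadget.IsGadgetMatrix Gc ng e D →
            Colourable k Gc ⇔ CombDMR-YES k D
theorem16 k nc Gc _ ng e enum D gm = mk⇔ colourable⇒CombDMR-YES CombDMR-YES⇒colourable
  where open Reduction {k} Gc enum {D} gm
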